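{- The algorithm Eag has competitive function $\frac{n}{2}$.
   Context: Online frequent items problem: an input sequence is $I=a_1,\ldots,a_n$ of items from an infinite universe, $n=|I|$, revealed one at a time. An algorithm maintains a buffer holding one item; $s_t$ is the buffer content after step $t$; at step $1$ the buffer receives $a_1$, and at each later step $t$ the algorithm either keeps $s_{t-1}$ or replaces it by $a_t$. With $f_I(a)=|\{i:a_i=a\}|/n$, the aggregate frequency of $\mathcal A$ on $I$ is $\mathcal A(I)=\sum_{t=1}^n f_I(s^{\mathcal A}_t)$ (to be maximized). Opt denotes an optimal offline algorithm (knows all of $I$ in advance, same buffer rules). Eag: let $t^*=\min\{t\in\{1,\ldots,n-1\}: a_t=a_{t+1}\}$ if such $t$ exists, else $t^*=n$; Eag sets $s_t=a_t$ for $t\le t^*$ and $s_t=a_{t^*}$ for $t>t^*$. Competitive function: $\mathcal A$ is $f(n)$-competitive if there is $h\in o(f)$ such that for all $I$ (with $n=|I|$), $\mathrm{Opt}(I)\le (f(n)+h(n))\,\mathcal A(I)$. $\mathcal A$ has competitive function $f(n)$ if it is $f(n)$-competitive and for every $g(n)$ such that $\mathcal A$ is $g(n)$-competitive, $\lim_{n\to\infty} f(n)/g(n)\le 1$.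
   Formalization: The functions $g(n)$ tested in the optimality clause, and the functions $h$ in the definition of competitiveness, take rational values only. -}

module Defs where

open import Data.Nat as ℕ using (ℕ; zero; suc; _≥_)
open import Data.Nat.Properties using (_≟_)
open import Data.Bool using (Bool; true; false; if_then_else_)
open import Data.List using (List; []; _∷_; length; filter; map; foldr; replicate; _++_)
open import Data.Product using (Σ; _×_; _,_; ∃)
open import Data.Integer using (+_)
open import Data.Rational using (ℚ; 0ℚ; 1ℚ; _+_; _*_; _≤_; _<_; ∣_∣; _⊔_) renaming (_/_ to _÷_)
open import Relation.Nullary using (yes; no)

Item : Set
Item = ℕ

-- A (nonempty) input sequence I = a₁ , a₂ , … , aₙ  is represented as
-- (a₁ , [a₂ , … , aₙ]).
Input : Set
Input = Item × List Item

toList : Input → List Item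
toList (a , as) = a ∷ as

len : Input → ℕ
len (a , as) = suc (length as)

count : Input → Item → ℕ
count I b = length (filter (λ x → x ≟ b) (toList I))

freq : Input → Item → ℚ
freq (a , as) b = (+ count (a , as) b) ÷ suc (length as)

sumℚ : List ℚ → ℚ
sumℚ = foldr _+_ 0ℚ

aggregate : Input → List Item → ℚ
aggregate I ss = sumℚ (map (freq I) ss)

-- A strategy is a list of decisions d₂ , d₃ , … (true = replace the buffer
-- by a_t, false = keep).  Missing decisions mean "keep", extra ones are
-- ignored.  Every valid buffer sequence arises from some decision list.

run : Item → List Item → List Bool → List Item
run b []       ds           = []
run b (x ∷ xs) []           = b ∷ run b xs []
run b (x ∷ xs) (false ∷ ds) = b ∷ run b xs ds
run b (x ∷ xs) (true  ∷ ds) = x ∷ run x xs ds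

buffers : Input → List Bool → List Item
buffers (a , as) ds = a ∷ run a as ds

allDecisions : ℕ → List (List Bool)
allDecisions zero    = [] ∷ []
allDecisions (suc k) = map (false ∷_) (allDecisions k) ++ map (true ∷_) (allDecisions k)

maxℚ : List ℚ → ℚ
maxℚ []       = 0ℚ
maxℚ (q ∷ qs) = q ⊔ maxℚ qs

Opt : Input → ℚ
Opt (a , as) = maxℚ (map (λ ds → aggregate (a , as) (buffers (a , as) ds))
                         (allDecisions (length as)))

eagRun : Item → List Item → List Item
eagRun a []       = a ∷ []
eagRun a (b ∷ bs) with a ≟ b
... | yes _ = a ∷ replicate (suc (length bs)) a
... | no  _ = a ∷ eagRun b bs

Eag : Input → ℚ
Eag (a , as) = aggregate (a , as) (eagRun a as)

little-o : (ℕ → ℚ) → (ℕ → ℚ) → Set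
little-o h f = ∀ (ε : ℚ) → 0ℚ < ε →
  ∃ λ (N : ℕ) → ∀ n → n ≥ N → ∣ h n ∣ ≤ ε * ∣ f n ∣

Competitive : (Input → ℚ) → (ℕ → ℚ) → Set
Competitive Alg f = Σ (ℕ → ℚ) λ h → little-o h f ×
  (∀ (I : Input) → Opt I ≤ (f (len I) + h (len I)) * Alg I)

-- lim_{n→∞} f(n)/g(n) ≤ 1, read as limsup: for every ε > 0,
-- eventually f(n) ≤ (1 + ε) g(n)
LimRatio≤1 : (ℕ → ℚ) → (ℕ → ℚ) → Set
LimRatio≤1 f g = ∀ (ε : ℚ) → 0ℚ < ε →
  ∃ λ (N : ℕ) → ∀ n → n ≥ N → f n ≤ (1ℚ + ε) * g n

HasCompetitiveFunction : (Input → ℚ) → (ℕ → ℚ) → Set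
HasCompetitiveFunction Alg f =
  Competitive Alg f × (∀ (g : ℕ → ℚ) → Competitive Alg g → LimRatio≤1 f g)

half : ℕ → ℚ
half n = (+ n) ÷ 2

-- Eag's buffer always holds an item occurring in I, and once it stops at a
-- repeated item b it holds b (count ≥ 2) for the rest of the run.  Writing E for
-- n · Eag(I), this gives E ≥ n and E ≥ 2·count(b) for every b with count(b) ≥ 2;
-- hence 2·count(x) ≤ E + 1 for every x, and any buffer sequence collects at most
-- n(E + 1)/2 ≤ (n + 1)E/2, i.e. Opt(I) ≤ (n/2 + 1/2) Eag(I).
-- Conversely on 0 0 1ᵐ Eag keeps 0 (Eag = 2) while following the input gives
-- (4 + m²)/(m + 2) ≥ n − 4, so a competitive g must eventually satisfy
-- n/2 ≤ (1 + ε) g(n).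
module Submission where

open import Defs
open import Data.Bool using (true; false)
open import Data.Empty using (⊥-elim)
open import Data.List using (List; []; _∷_; length; filter; map; replicate)
import Data.List.Properties as ListP
open import Data.List.Membership.Propositional using (_∈_)
open import Data.List.Membership.Propositional.Properties using (∈-map⁺; ∈-++⁺ʳ)
open import Data.List.Relation.Unary.Any using (here; there)
open import Data.Nat using (ℕ; zero; suc; _+_; _*_; _∸_; _≤_; _<_; _≥_; z≤n; s≤s; NonZero; _≤?_)
import Data.Nat.Properties as ℕP
open import Data.Nat.Properties using (_≟_)
open import Data.Nat.ListAction using (sum)
open import Data.Nat.Solver using (module +-*-Solver)
import Data.Integer as ℤ
open import Data.Integer using (+_; -[1+_])
import Data.Integer.Properties as ℤP
import Data.Rational as ℚ
open import Data.Rational using (ℚ; mkℚ; 0ℚ; 1ℚ; ½; ∣_∣; -_; toℚᵘ) renaming (_/_ to _÷_)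
import Data.Rational.Properties as ℚP
import Data.Rational.Unnormalised as ℚᵘ
open import Data.Rational.Unnormalised using (mkℚᵘ; *≡*; *≤*; *<*)
import Data.Rational.Unnormalised.Properties as ℚᵘP
open import Data.Product using (∃₂; _,_; proj₁; proj₂)
open import Data.Sum using (inj₁; inj₂)
open import Relation.Nullary using (yes; no; contradiction)
open import Relation.Binary.PropositionalEquality

open +-*-Solver using (solve; _:+_; _:*_; _:=_; con)

toℚᵘ-÷ : ∀ a k → toℚᵘ ((+ a) ÷ suc k) ℚᵘ.≃ mkℚᵘ (+ a) k
toℚᵘ-÷ a k = ℚP.toℚᵘ-fromℚᵘ (mkℚᵘ (+ a) k)

÷-cross-≡ : ∀ a b c d .{{_ : NonZero b}} .{{_ : NonZero d}} →
            a * d ≡ c * b → (+ a) ÷ b ≡ (+ c) ÷ d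
÷-cross-≡ a (suc k) c (suc l) eq = ℚP.toℚᵘ-injective
  (ℚᵘP.≃-trans (toℚᵘ-÷ a k) (ℚᵘP.≃-trans (*≡* cross) (ℚᵘP.≃-sym (toℚᵘ-÷ c l))))
  where
  cross : + a ℤ.* + suc l ≡ + c ℤ.* + suc k
  cross = trans (sym (ℤP.pos-* a (suc l))) (trans (cong +_ eq) (ℤP.pos-* c (suc k)))

÷-cross-≤ : ∀ a b c d .{{_ : NonZero b}} .{{_ : NonZero d}} →
            a * d ≤ c * b → (+ a) ÷ b ℚ.≤ (+ c) ÷ d
÷-cross-≤ a (suc k) c (suc l) le = ℚP.toℚᵘ-cancel-≤
  (ℚᵘP.≤-respˡ-≃ (ℚᵘP.≃-sym (toℚᵘ-÷ a k)) (ℚᵘP.≤-respʳ-≃ (ℚᵘP.≃-sym (toℚᵘ-÷ c l)) (*≤* cross)))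
  where
  cross : + a ℤ.* + suc l ℤ.≤ + c ℤ.* + suc k
  cross = subst₂ ℤ._≤_ (ℤP.pos-* a (suc l)) (ℤP.pos-* c (suc k)) (ℤ.+≤+ le)

÷-cross-< : ∀ a b c d .{{_ : NonZero b}} .{{_ : NonZero d}} →
            a * d < c * b → (+ a) ÷ b ℚ.< (+ c) ÷ d
÷-cross-< a (suc k) c (suc l) lt = ℚP.toℚᵘ-cancel-<
  (ℚᵘP.<-respˡ-≃ (ℚᵘP.≃-sym (toℚᵘ-÷ a k)) (ℚᵘP.<-respʳ-≃ (ℚᵘP.≃-sym (toℚᵘ-÷ c l)) (*<* cross)))
  where
  cross : + a ℤ.* + suc l ℤ.< + c ℤ.* + suc k
  cross = subst₂ ℤ._<_ (ℤP.pos-* a (suc l)) (ℤP.pos-* c (suc k)) (ℤ.+<+ lt)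

÷-+-÷ : ∀ a b c d .{{_ : NonZero b}} .{{_ : NonZero d}} →
        (+ a) ÷ b ℚ.+ (+ c) ÷ d ≡ ((+ (a * d + c * b)) ÷ (b * d)) {{ℕP.m*n≢0 b d}}
÷-+-÷ a (suc k) c (suc l) = ℚP.toℚᵘ-injective
  (ℚᵘP.≃-trans (ℚP.toℚᵘ-homo-+ ((+ a) ÷ suc k) ((+ c) ÷ suc l))
  (ℚᵘP.≃-trans (ℚᵘP.+-cong (toℚᵘ-÷ a k) (toℚᵘ-÷ c l))
  (ℚᵘP.≃-trans (*≡* (cong (ℤ._* + suc (l + k * suc l)) numerator))
               (ℚᵘP.≃-sym (toℚᵘ-÷ (a * suc l + c * suc k) (l + k * suc l))))))
  where
  numerator : + a ℤ.* + suc l ℤ.+ + c ℤ.* + suc k ≡ + (a * suc l + c * suc k)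
  numerator = sym (trans (ℤP.pos-+ (a * suc l) (c * suc k))
                         (cong₂ ℤ._+_ (ℤP.pos-* a (suc l)) (ℤP.pos-* c (suc k))))

÷-*-÷ : ∀ a b c d .{{_ : NonZero b}} .{{_ : NonZero d}} →
        ((+ a) ÷ b) ℚ.* ((+ c) ÷ d) ≡ ((+ (a * c)) ÷ (b * d)) {{ℕP.m*n≢0 b d}}
÷-*-÷ a (suc k) c (suc l) = ℚP.toℚᵘ-injective
  (ℚᵘP.≃-trans (ℚP.toℚᵘ-homo-* ((+ a) ÷ suc k) ((+ c) ÷ suc l))
  (ℚᵘP.≃-trans (ℚᵘP.*-cong (toℚᵘ-÷ a k) (toℚᵘ-÷ c l))
  (ℚᵘP.≃-trans (*≡* (cong (ℤ._* + suc (l + k * suc l)) (sym (ℤP.pos-* a c))))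
               (ℚᵘP.≃-sym (toℚᵘ-÷ (a * c) (l + k * suc l))))))

÷-+-same : ∀ a c n .{{_ : NonZero n}} → (+ a) ÷ n ℚ.+ (+ c) ÷ n ≡ (+ (a + c)) ÷ n
÷-+-same a c n@(suc _) = trans (÷-+-÷ a n c n) (÷-cross-≡ (a * n + c * n) (n * n) (a + c) n
  (solve 3 (λ a c n → (a :* n :+ c :* n) :* n := (a :+ c) :* (n :* n)) refl a c n))

positive-÷ : ∀ {ε} → 0ℚ ℚ.< ε → ∃₂ λ p q → ε ≡ (+ suc p) ÷ suc q
positive-÷ {mkℚ (+ zero) q _}  (ℚ.*<* (ℤ.+<+ ()))
positive-÷ {mkℚ (+ suc p) q _} _ = p , q , ℚP.toℚᵘ-injective (ℚᵘP.≃-sym (toℚᵘ-÷ (suc p) q))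
positive-÷ {mkℚ -[1+ p ] q _}  (ℚ.*<* ())

occurrences : List Item → Item → ℕ
occurrences xs b = length (filter (_≟ b) xs)

occurrences-here : ∀ x xs → occurrences (x ∷ xs) x ≡ suc (occurrences xs x)
occurrences-here x xs = cong length (ListP.filter-accept (_≟ x) refl)

occurrences-there : ∀ {x b} xs → x ≢ b → occurrences (x ∷ xs) b ≡ occurrences xs b
occurrences-there {b = b} xs x≢b = cong length (ListP.filter-reject (_≟ b) x≢b)

occurrences≤length : ∀ xs b → occurrences xs b ≤ length xs
occurrences≤length []       b = z≤n
occurrences≤length (x ∷ xs) b with x ≟ b
... | yes refl rewrite occurrences-here x xs   = s≤s (occurrences≤length xs b)
... | no  x≢b rewrite occurrences-there xs x≢b = ℕP.m≤n⇒m≤1+n (occurrences≤length xs b)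

occurrences-∷ : ∀ x xs b → occurrences xs b ≤ occurrences (x ∷ xs) b
occurrences-∷ x xs b with x ≟ b
... | yes refl rewrite occurrences-here x xs   = ℕP.n≤1+n _
... | no  x≢b rewrite occurrences-there xs x≢b = ℕP.≤-refl

-- Induction along Eag's run needs the counts in the whole input to bound those
-- of every suffix.
Bounds : (Item → ℕ) → List Item → Set
Bounds C xs = ∀ x → occurrences xs x ≤ C x

Bounds-tail : ∀ {C} x xs → Bounds C (x ∷ xs) → Bounds C xs
Bounds-tail x xs bound y = ℕP.≤-trans (occurrences-∷ x xs y) (bound y)

1≤Bounds-head : ∀ {C} x xs → Bounds C (x ∷ xs) → 1 ≤ C x
1≤Bounds-head x xs bound =
  ℕP.≤-trans (s≤s z≤n) (subst (_≤ _) (occurrences-here x xs) (bound x))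

2≤Bounds-repeated : ∀ {C} x xs → Bounds C (x ∷ x ∷ xs) → 2 ≤ C x
2≤Bounds-repeated x xs bound =
  ℕP.≤-trans (s≤s (s≤s z≤n))
    (subst (_≤ _) (trans (occurrences-here x (x ∷ xs)) (cong suc (occurrences-here x xs))) (bound x))

weight : (Item → ℕ) → List Item → ℕ
weight C xs = sum (map C xs)

weight-replicate : ∀ C k a → weight C (replicate k a) ≡ k * C a
weight-replicate C zero    a = refl
weight-replicate C (suc k) a = cong (λ w → C a + w) (weight-replicate C k a)

weight-bounded : ∀ C K → (∀ x → 2 * C x ≤ K) → ∀ xs → 2 * weight C xs ≤ length xs * K
weight-bounded C K bound []       = z≤n
weight-bounded C K bound (x ∷ xs) = ℕP.≤-trans (ℕP.≤-reflexive (ℕP.*-distribˡ-+ 2 (C x) (weight C xs)))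
                                              (ℕP.+-mono-≤ (bound x) (weight-bounded C K bound xs))

aggregate-÷ : ∀ a as ss → aggregate (a , as) ss ≡ (+ weight (count (a , as)) ss) ÷ suc (length as)
aggregate-÷ a as []       = ÷-cross-≡ 0 1 0 (suc (length as)) refl
aggregate-÷ a as (s ∷ ss) =
  trans (cong (freq (a , as) s ℚ.+_) (aggregate-÷ a as ss))
        (÷-+-same (count (a , as) s) (weight (count (a , as)) ss) (suc (length as)))

count-Bounds : ∀ a as → Bounds (count (a , as)) (a ∷ as)
count-Bounds a as x = ℕP.≤-refl

length≤weight-eagRun : ∀ C a bs → Bounds C (a ∷ bs) → suc (length bs) ≤ weight C (eagRun a bs)
length≤weight-eagRun C a []       bound = ℕP.≤-trans (1≤Bounds-head a [] bound) (ℕP.m≤m+n (C a) 0)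
length≤weight-eagRun C a (b ∷ bs) bound with a ≟ b
... | yes refl = begin
  suc (suc (length bs))                    ≡⟨ ℕP.*-identityʳ _ ⟨
  suc (suc (length bs)) * 1                ≤⟨ ℕP.*-monoʳ-≤ (suc (suc (length bs))) (1≤Bounds-head a (a ∷ bs) bound) ⟩
  C a + suc (length bs) * C a              ≡⟨ cong (λ w → C a + w) (weight-replicate C (suc (length bs)) a) ⟨
  C a + weight C (replicate (suc (length bs)) a) ∎
  where open ℕP.≤-Reasoning
... | no  _    = ℕP.+-mono-≤ (1≤Bounds-head a (b ∷ bs) bound) (length≤weight-eagRun C b bs (Bounds-tail a (b ∷ bs) bound))

-- Every occurrence of b before Eag stops contributes C b ≥ 2; if Eag stops at a
-- repeated a, each later position contributes C a ≥ 2.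
2*occurrences≤weight-eagRun : ∀ C a bs → Bounds C (a ∷ bs) →
  ∀ b → 2 ≤ C b → 2 * occurrences (a ∷ bs) b ≤ weight C (eagRun a bs)
2*occurrences≤weight-eagRun C a [] bound b 2≤Cb with a ≟ b
... | yes refl rewrite occurrences-here a []     = ℕP.≤-trans 2≤Cb (ℕP.m≤m+n (C a) 0)
... | no  a≢b  rewrite occurrences-there [] a≢b     = z≤n
2*occurrences≤weight-eagRun C a (a′ ∷ bs) bound b 2≤Cb with a ≟ a′
... | yes refl = begin
  2 * occurrences (a ∷ a ∷ bs) b    ≤⟨ ℕP.*-mono-≤ (2≤Bounds-repeated a bs bound) (occurrences≤length (a ∷ a ∷ bs) b) ⟩
  C a * suc (suc (length bs))       ≡⟨ ℕP.*-comm (C a) _ ⟩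
  C a + suc (length bs) * C a       ≡⟨ cong (λ w → C a + w) (weight-replicate C (suc (length bs)) a) ⟨
  C a + weight C (replicate (suc (length bs)) a) ∎
  where open ℕP.≤-Reasoning
... | no  _    = head-step
  where
  rest : 2 * occurrences (a′ ∷ bs) b ≤ weight C (eagRun a′ bs)
  rest = 2*occurrences≤weight-eagRun C a′ bs (Bounds-tail a (a′ ∷ bs) bound) b 2≤Cb
  head-step : 2 * occurrences (a ∷ a′ ∷ bs) b ≤ C a + weight C (eagRun a′ bs)
  head-step with a ≟ b
  ... | yes refl rewrite occurrences-here a (a′ ∷ bs) =
    ℕP.≤-trans (ℕP.≤-reflexive (ℕP.*-distribˡ-+ 2 1 (occurrences (a′ ∷ bs) a))) (ℕP.+-mono-≤ 2≤Cb rest)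
  ... | no  a≢b  rewrite occurrences-there (a′ ∷ bs) a≢b = ℕP.≤-trans rest (ℕP.m≤n+m _ (C a))

2*count≤1+weight-eagRun : ∀ a as x → 2 * count (a , as) x ≤ suc (weight (count (a , as)) (eagRun a as))
2*count≤1+weight-eagRun a as x with count (a , as) x ≤? 1
... | yes c≤1 = ℕP.≤-trans (ℕP.*-monoʳ-≤ 2 c≤1)
                  (s≤s (ℕP.≤-trans (s≤s z≤n) (length≤weight-eagRun (count (a , as)) a as (count-Bounds a as))))
... | no  c≰1 = ℕP.m≤n⇒m≤1+n (2*occurrences≤weight-eagRun (count (a , as)) a as (count-Bounds a as) x (ℕP.≰⇒> c≰1))

eagRun-repeated : ∀ a bs → eagRun a (a ∷ bs) ≡ a ∷ replicate (suc (length bs)) a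
eagRun-repeated a bs with a ≟ a
... | yes _   = refl
... | no  a≢a = contradiction refl a≢a

Eag-repeated-head : ∀ a as → Eag (a , a ∷ as) ≡ (+ count (a , a ∷ as) a) ÷ 1
Eag-repeated-head a as = begin
  Eag (a , a ∷ as)                              ≡⟨ cong (aggregate (a , a ∷ as)) (eagRun-repeated a as) ⟩
  aggregate (a , a ∷ as) (a ∷ replicate n a)    ≡⟨ aggregate-÷ a (a ∷ as) (a ∷ replicate n a) ⟩
  (+ (C a + weight C (replicate n a))) ÷ suc n  ≡⟨ cong (λ w → (+ (C a + w)) ÷ suc n) (weight-replicate C n a) ⟩
  (+ (suc n * C a)) ÷ suc n                     ≡⟨ ÷-cross-≡ (suc n * C a) (suc n) (C a) 1 (trans (ℕP.*-identityʳ _) (ℕP.*-comm (suc n) (C a))) ⟩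
  (+ C a) ÷ 1                                   ∎
  where
  open ≡-Reasoning
  n : ℕ
  n = suc (length as)
  C : Item → ℕ
  C = count (a , a ∷ as)

length-run : ∀ b xs ds → length (run b xs ds) ≡ length xs
length-run b []       ds           = refl
length-run b (x ∷ xs) []           = cong suc (length-run b xs [])
length-run b (x ∷ xs) (false ∷ ds) = cong suc (length-run b xs ds)
length-run b (x ∷ xs) (true  ∷ ds) = cong suc (length-run x xs ds)

run-allTrue : ∀ b xs → run b xs (replicate (length xs) true) ≡ xs
run-allTrue b []       = refl
run-allTrue b (x ∷ xs) = cong (x ∷_) (run-allTrue x xs)

allTrue∈allDecisions : ∀ k → replicate k true ∈ allDecisions k
allTrue∈allDecisions zero    = here refl
allTrue∈allDecisions (suc k) = ∈-++⁺ʳ (map (false ∷_) (allDecisions k)) (∈-map⁺ (true ∷_) (allTrue∈allDecisions k))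

∈⇒≤maxℚ : ∀ {q qs} → q ∈ qs → q ℚ.≤ maxℚ qs
∈⇒≤maxℚ {qs = q′ ∷ qs} (here refl) = ℚP.p≤p⊔q q′ (maxℚ qs)
∈⇒≤maxℚ {qs = q′ ∷ qs} (there q∈qs) = ℚP.≤-trans (∈⇒≤maxℚ q∈qs) (ℚP.p≤q⊔p q′ (maxℚ qs))

maxℚ-map-≤ : ∀ {A : Set} (f : A → ℚ) {B} → (∀ x → f x ℚ.≤ B) → 0ℚ ℚ.≤ B → ∀ xs → maxℚ (map f xs) ℚ.≤ B
maxℚ-map-≤ f f≤B 0≤B []       = 0≤B
maxℚ-map-≤ f f≤B 0≤B (x ∷ xs) = ℚP.⊔-lub (f≤B x) (maxℚ-map-≤ f f≤B 0≤B xs)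

aggregate-toList≤Opt : ∀ I → aggregate I (toList I) ℚ.≤ Opt I
aggregate-toList≤Opt (a , as) =
  subst (ℚ._≤ Opt (a , as)) (cong (λ ss → aggregate (a , as) (a ∷ ss)) (run-allTrue a as))
        (∈⇒≤maxℚ (∈-map⁺ (λ ds → aggregate (a , as) (buffers (a , as) ds)) (allTrue∈allDecisions (length as))))

-- Upper bound

Opt≤[half+½]*Eag : ∀ I → Opt I ℚ.≤ (half (len I) ℚ.+ ½) ℚ.* Eag I
Opt≤[half+½]*Eag (a , as) =
  subst (Opt (a , as) ℚ.≤_) (sym bound≡)
    (maxℚ-map-≤ (λ ds → aggregate (a , as) (buffers (a , as) ds)) strategy≤
                (÷-cross-≤ 0 1 ((n * 2 + 1 * 2) * E) (2 * 2 * n) z≤n) (allDecisions (length as)))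
  where
  n : ℕ
  n = suc (length as)
  C : Item → ℕ
  C = count (a , as)
  E : ℕ
  E = weight C (eagRun a as)
  bound≡ : (half n ℚ.+ ½) ℚ.* Eag (a , as) ≡ (+ ((n * 2 + 1 * 2) * E)) ÷ (2 * 2 * n)
  bound≡ = trans (cong₂ ℚ._*_ (÷-+-÷ n 2 1 2) (aggregate-÷ a as (eagRun a as))) (÷-*-÷ (n * 2 + 1 * 2) (2 * 2) E n)
  2*weight≤ : ∀ ds → 2 * weight C (buffers (a , as) ds) ≤ (n + 1) * E
  2*weight≤ ds = begin
    2 * weight C (buffers (a , as) ds)  ≤⟨ weight-bounded C (suc E) (2*count≤1+weight-eagRun a as) (buffers (a , as) ds) ⟩
    length (a ∷ run a as ds) * suc E    ≡⟨ cong (λ k → suc k * suc E) (length-run a as ds) ⟩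
    n * suc E                           ≡⟨ ℕP.*-suc n E ⟩
    n + n * E                           ≤⟨ ℕP.+-monoˡ-≤ (n * E) (length≤weight-eagRun C a as (count-Bounds a as)) ⟩
    (1 + n) * E                         ≡⟨ cong (_* E) (ℕP.+-comm 1 n) ⟩
    (n + 1) * E                         ∎
    where open ℕP.≤-Reasoning
  strategy≤ : ∀ ds → aggregate (a , as) (buffers (a , as) ds) ℚ.≤ (+ ((n * 2 + 1 * 2) * E)) ÷ (2 * 2 * n)
  strategy≤ ds = subst (ℚ._≤ _) (sym (aggregate-÷ a as (buffers (a , as) ds)))
    (÷-cross-≤ S n ((n * 2 + 1 * 2) * E) (2 * 2 * n) (begin
      S * (2 * 2 * n)             ≡⟨ solve 2 (λ s m → s :* (con 2 :* con 2 :* m) := (con 2 :* s) :* (con 2 :* m)) refl S n ⟩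
      (2 * S) * (2 * n)           ≤⟨ ℕP.*-monoˡ-≤ (2 * n) (2*weight≤ ds) ⟩
      ((n + 1) * E) * (2 * n)     ≡⟨ solve 2 (λ m e → ((m :+ con 1) :* e) :* (con 2 :* m) := ((m :* con 2 :+ con 1 :* con 2) :* e) :* m) refl n E ⟩
      ((n * 2 + 1 * 2) * E) * n   ∎))
    where
    open ℕP.≤-Reasoning
    S : ℕ
    S = weight C (buffers (a , as) ds)

½∈o[half] : little-o (λ _ → ½) half
½∈o[half] ε 0<ε with positive-÷ 0<ε
... | p , q , refl = suc q , λ n n≥q →
  subst (λ x → ½ ℚ.≤ ((+ suc p) ÷ suc q) ℚ.* x) (sym (ℚP.0≤p⇒∣p∣≡p (÷-cross-≤ 0 1 n 2 z≤n)))
    (subst (½ ℚ.≤_) (sym (÷-*-÷ (suc p) (suc q) n 2))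
      (÷-cross-≤ 1 2 (suc p * n) (suc q * 2) (begin
        1 * (suc q * 2)     ≡⟨ ℕP.*-identityˡ _ ⟩
        suc q * 2           ≤⟨ ℕP.*-monoˡ-≤ 2 n≥q ⟩
        n * 2               ≤⟨ ℕP.*-monoˡ-≤ 2 (ℕP.m≤n*m n (suc p)) ⟩
        suc p * n * 2       ∎)))
  where open ℕP.≤-Reasoning

-- Lower bound

hardInput : ℕ → Input
hardInput m = 0 , 0 ∷ replicate m 1

hardInput-count₀ : ∀ m → count (hardInput m) 0 ≡ 2
hardInput-count₀ m = trans (occurrences-here 0 (0 ∷ replicate m 1))
                           (cong suc (trans (occurrences-here 0 (replicate m 1)) (cong suc (ones m))))
  where
  ones : ∀ m → occurrences (replicate m 1) 0 ≡ 0
  ones zero    = refl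
  ones (suc m) = trans (occurrences-there {1} {0} (replicate m 1) (λ ())) (ones m)

hardInput-count₁ : ∀ m → count (hardInput m) 1 ≡ m
hardInput-count₁ m = trans (occurrences-there {0} {1} (0 ∷ replicate m 1) (λ ()))
                           (trans (occurrences-there {0} {1} (replicate m 1) (λ ())) (ones m))
  where
  ones : ∀ m → occurrences (replicate m 1) 1 ≡ m
  ones zero    = refl
  ones (suc m) = trans (occurrences-here 1 (replicate m 1)) (cong suc (ones m))

Eag-hardInput : ∀ m → Eag (hardInput m) ≡ (+ 2) ÷ 1
Eag-hardInput m = trans (Eag-repeated-head 0 (replicate m 1)) (cong (λ c → (+ c) ÷ 1) (hardInput-count₀ m))

Opt-hardInput : ∀ m → (+ (4 + m * m)) ÷ (2 + m) ℚ.≤ Opt (hardInput m)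
Opt-hardInput m = subst (ℚ._≤ Opt (hardInput m)) follow≡ (aggregate-toList≤Opt (hardInput m))
  where
  C : Item → ℕ
  C = count (hardInput m)
  weight≡ : weight C (toList (hardInput m)) ≡ 4 + m * m
  weight≡ = trans (cong (λ w → C 0 + (C 0 + w)) (weight-replicate C m 1))
                  (cong₂ (λ c₀ c₁ → c₀ + (c₀ + m * c₁)) (hardInput-count₀ m) (hardInput-count₁ m))
  follow≡ : aggregate (hardInput m) (toList (hardInput m)) ≡ (+ (4 + m * m)) ÷ (2 + m)
  follow≡ = trans (aggregate-÷ 0 (0 ∷ replicate m 1) (toList (hardInput m)))
                  (ℚP./-cong (cong +_ weight≡) (cong (λ k → 2 + k) (ListP.length-replicate m)))

competitive-on-hardInput : ∀ (g h : ℕ → ℚ) → (∀ I → Opt I ℚ.≤ (g (len I) ℚ.+ h (len I)) ℚ.* Eag I) →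
  ∀ m → (+ (4 + m * m)) ÷ (2 + m) ℚ.≤ (g (2 + m) ℚ.+ h (2 + m)) ℚ.* ((+ 2) ÷ 1)
competitive-on-hardInput g h competitive m = ℚP.≤-trans (Opt-hardInput m)
  (subst₂ (λ k e → Opt (hardInput m) ℚ.≤ (g k ℚ.+ h k) ℚ.* e)
          (cong (λ k → 2 + k) (ListP.length-replicate m)) (Eag-hardInput m) (competitive (hardInput m)))

p≤∣p∣ : ∀ p → p ℚ.≤ ∣ p ∣
p≤∣p∣ (mkℚ (+ n) d c)      = ℚP.≤-refl
p≤∣p∣ p@(mkℚ -[1+ n ] d c) = ℚP.≤-trans (ℚP.<⇒≤ (ℚP.negative⁻¹ p)) (ℚP.0≤∣p∣ p)

-- If G < 0, then G + H ≤ G + ∣G∣ = 0.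
perturbation-≤ : ∀ {G H δ} → 0ℚ ℚ.< G ℚ.+ H → ∣ H ∣ ℚ.≤ δ ℚ.* ∣ G ∣ → δ ℚ.≤ 1ℚ →
                 G ℚ.+ H ℚ.≤ (1ℚ ℚ.+ δ) ℚ.* G
perturbation-≤ {G} {H} {δ} 0<G+H H≤δG δ≤1 with ℚP.∣p∣≡p∨∣p∣≡-p G
... | inj₁ ∣G∣≡G = begin
  G ℚ.+ H            ≤⟨ ℚP.+-monoʳ-≤ G (ℚP.≤-trans (p≤∣p∣ H) (subst (λ x → ∣ H ∣ ℚ.≤ δ ℚ.* x) ∣G∣≡G H≤δG)) ⟩
  G ℚ.+ δ ℚ.* G      ≡⟨ cong (ℚ._+ δ ℚ.* G) (ℚP.*-identityˡ G) ⟨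
  1ℚ ℚ.* G ℚ.+ δ ℚ.* G ≡⟨ ℚP.*-distribʳ-+ G 1ℚ δ ⟨
  (1ℚ ℚ.+ δ) ℚ.* G   ∎
  where open ℚP.≤-Reasoning
... | inj₂ ∣G∣≡-G = ⊥-elim (ℚP.<-irrefl refl (ℚP.<-≤-trans 0<G+H G+H≤0))
  where
  open ℚP.≤-Reasoning
  G+H≤0 : G ℚ.+ H ℚ.≤ 0ℚ
  G+H≤0 = begin
    G ℚ.+ H          ≤⟨ ℚP.+-monoʳ-≤ G (ℚP.≤-trans (p≤∣p∣ H) H≤δG) ⟩
    G ℚ.+ δ ℚ.* ∣ G ∣ ≤⟨ ℚP.+-monoʳ-≤ G (ℚP.*-monoʳ-≤-nonNeg ∣ G ∣ {{ℚ.nonNegative (ℚP.0≤∣p∣ G)}} δ≤1) ⟩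
    G ℚ.+ 1ℚ ℚ.* ∣ G ∣ ≡⟨ cong (G ℚ.+_) (trans (ℚP.*-identityˡ ∣ G ∣) ∣G∣≡-G) ⟩
    G ℚ.+ - G         ≡⟨ ℚP.+-inverseʳ G ⟩
    0ℚ                ∎

hardInput-gap : ∀ a b m .{{_ : NonZero a}} → 8 * b ≤ m →
                2 * b * ((2 + m) * (2 + m)) ≤ (a + 2 * b) * (4 + m * m)
hardInput-gap a b m 8b≤m = begin
  2 * b * ((2 + m) * (2 + m))                         ≡⟨ solve 2 (λ b m → con 2 :* b :* ((con 2 :+ m) :* (con 2 :+ m))
                                                            := con 2 :* b :* (m :* m) :+ con 8 :* b :* m :+ con 8 :* b) refl b m ⟩
  2 * b * (m * m) + 8 * b * m + 8 * b                 ≤⟨ ℕP.+-monoˡ-≤ (8 * b) (ℕP.+-monoʳ-≤ (2 * b * (m * m)) 8bm≤amm) ⟩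
  2 * b * (m * m) + a * (m * m) + 8 * b               ≤⟨ ℕP.m≤m+n _ (4 * a) ⟩
  2 * b * (m * m) + a * (m * m) + 8 * b + 4 * a       ≡⟨ solve 3 (λ a b m → con 2 :* b :* (m :* m) :+ a :* (m :* m) :+ con 8 :* b :+ con 4 :* a
                                                            := (a :+ con 2 :* b) :* (con 4 :+ m :* m)) refl a b m ⟩
  (a + 2 * b) * (4 + m * m)                           ∎
  where
  open ℕP.≤-Reasoning
  8bm≤amm : 8 * b * m ≤ a * (m * m)
  8bm≤amm = ℕP.≤-trans (ℕP.*-monoˡ-≤ m 8b≤m) (ℕP.m≤n*m (m * m) a)

-- Writing ε = a/b, the tolerance δ = a/(a + 2b) is chosen so that
-- 1 + ε = (1 + ε/2)(1 + δ).
tolerance : ℕ → ℕ → ℚ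
tolerance p q = (+ suc p) ÷ (suc p + 2 * suc q)

0<tolerance : ∀ p q → 0ℚ ℚ.< tolerance p q
0<tolerance p q = ÷-cross-< 0 1 (suc p) (suc p + 2 * suc q) (s≤s z≤n)

tolerance≤1 : ∀ p q → tolerance p q ℚ.≤ 1ℚ
tolerance≤1 p q = ÷-cross-≤ (suc p) (suc p + 2 * suc q) 1 1
  (ℕP.≤-trans (ℕP.≤-reflexive (ℕP.*-identityʳ (suc p)))
  (ℕP.≤-trans (ℕP.m≤m+n (suc p) (2 * suc q)) (ℕP.≤-reflexive (sym (ℕP.*-identityˡ _)))))

half≤scaled-hardInput-value : ∀ a q m .{{_ : NonZero a}} → 8 * suc q ≤ m →
  half (2 + m) ℚ.≤ ((+ (a + 2 * suc q)) ÷ (2 * suc q)) ℚ.* (((+ (4 + m * m)) ÷ (2 + m)) ℚ.* ½)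
half≤scaled-hardInput-value a q m 8b≤m = subst (half (2 + m) ℚ.≤_)
  (sym (trans (cong ((+ (a + 2 * b)) ÷ (2 * b) ℚ.*_) (÷-*-÷ (4 + m * m) (2 + m) 1 2))
              (÷-*-÷ (a + 2 * b) (2 * b) ((4 + m * m) * 1) ((2 + m) * 2))))
  (÷-cross-≤ (2 + m) 2 ((a + 2 * b) * ((4 + m * m) * 1)) (2 * b * ((2 + m) * 2)) (begin
    (2 + m) * (2 * b * ((2 + m) * 2))     ≡⟨ solve 2 (λ b m → (con 2 :+ m) :* (con 2 :* b :* ((con 2 :+ m) :* con 2))
                                               := con 2 :* (con 2 :* b :* ((con 2 :+ m) :* (con 2 :+ m)))) refl b m ⟩
    2 * (2 * b * ((2 + m) * (2 + m)))     ≤⟨ ℕP.*-monoʳ-≤ 2 (hardInput-gap a b m 8b≤m) ⟩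
    2 * ((a + 2 * b) * (4 + m * m))       ≡⟨ solve 3 (λ a b m → con 2 :* ((a :+ con 2 :* b) :* (con 4 :+ m :* m))
                                               := (a :+ con 2 :* b) :* ((con 4 :+ m :* m) :* con 1) :* con 2) refl a b m ⟩
    (a + 2 * b) * ((4 + m * m) * 1) * 2   ∎))
  where
  open ℕP.≤-Reasoning
  b : ℕ
  b = suc q

[1+ε/2]*[1+tolerance]≡1+ε : ∀ p q →
  ((+ (suc p + 2 * suc q)) ÷ (2 * suc q)) ℚ.* (1ℚ ℚ.+ tolerance p q) ≡ 1ℚ ℚ.+ (+ suc p) ÷ suc q
[1+ε/2]*[1+tolerance]≡1+ε p q =
  trans (cong ((+ (a + 2 * b)) ÷ (2 * b) ℚ.*_) (÷-+-÷ 1 1 a (a + 2 * b)))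
  (trans (÷-*-÷ (a + 2 * b) (2 * b) (1 * (a + 2 * b) + a * 1) (1 * (a + 2 * b)))
  (trans (÷-cross-≡ ((a + 2 * b) * (1 * (a + 2 * b) + a * 1)) (2 * b * (1 * (a + 2 * b))) (1 * b + a * 1) (1 * b)
           (solve 2 (λ a b → (a :+ con 2 :* b) :* (con 1 :* (a :+ con 2 :* b) :+ a :* con 1) :* (con 1 :* b)
                     := (con 1 :* b :+ a :* con 1) :* (con 2 :* b :* (con 1 :* (a :+ con 2 :* b)))) refl a b))
  (sym (÷-+-÷ 1 1 a b))))
  where
  a b : ℕ
  a = suc p
  b = suc q

half-≤-from-hardInput : ∀ p q m {G H : ℚ} → 8 * suc q ≤ m →
  (+ (4 + m * m)) ÷ (2 + m) ℚ.≤ (G ℚ.+ H) ℚ.* ((+ 2) ÷ 1) →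
  ∣ H ∣ ℚ.≤ tolerance p q ℚ.* ∣ G ∣ →
  half (2 + m) ℚ.≤ (1ℚ ℚ.+ (+ suc p) ÷ suc q) ℚ.* G
half-≤-from-hardInput p q m {G} {H} 8b≤m X≤[G+H]*2 H≤δG = begin
  half (2 + m)                 ≤⟨ half≤scaled-hardInput-value (suc p) q m 8b≤m ⟩
  c ℚ.* (X ℚ.* ½)              ≤⟨ ℚP.*-monoˡ-≤-nonNeg c {{ℚP.normalize-nonNeg (suc p + 2 * suc q) (2 * suc q)}}
                                    (ℚP.≤-trans X½≤G+H (perturbation-≤ (ℚP.<-≤-trans 0<X½ X½≤G+H) H≤δG (tolerance≤1 p q))) ⟩
  c ℚ.* ((1ℚ ℚ.+ δ) ℚ.* G)     ≡⟨ ℚP.*-assoc c (1ℚ ℚ.+ δ) G ⟨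
  (c ℚ.* (1ℚ ℚ.+ δ)) ℚ.* G     ≡⟨ cong (ℚ._* G) ([1+ε/2]*[1+tolerance]≡1+ε p q) ⟩
  (1ℚ ℚ.+ (+ suc p) ÷ suc q) ℚ.* G ∎
  where
  open ℚP.≤-Reasoning
  δ c X : ℚ
  δ = tolerance p q
  c = (+ (suc p + 2 * suc q)) ÷ (2 * suc q)
  X = (+ (4 + m * m)) ÷ (2 + m)
  0<X½ : 0ℚ ℚ.< X ℚ.* ½
  0<X½ = subst (0ℚ ℚ.<_) (sym (÷-*-÷ (4 + m * m) (2 + m) 1 2))
               (÷-cross-< 0 1 ((4 + m * m) * 1) ((2 + m) * 2) (s≤s z≤n))
  X½≤G+H : X ℚ.* ½ ℚ.≤ G ℚ.+ H
  X½≤G+H = ℚP.≤-trans (ℚP.*-monoʳ-≤-nonNeg ½ X≤[G+H]*2)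
             (ℚP.≤-reflexive (trans (ℚP.*-assoc (G ℚ.+ H) ((+ 2) ÷ 1) ½) (ℚP.*-identityʳ (G ℚ.+ H))))

half-minimal : ∀ g → Competitive Eag g → LimRatio≤1 half g
half-minimal g (h , h∈o[g] , competitive) ε 0<ε = N₀ + (8 * suc q + 2) , bound
  where
  p q : ℕ
  p = proj₁ (positive-÷ 0<ε)
  q = proj₁ (proj₂ (positive-÷ 0<ε))
  ε≡ : ε ≡ (+ suc p) ÷ suc q
  ε≡ = proj₂ (proj₂ (positive-÷ 0<ε))
  N₀ : ℕ
  N₀ = proj₁ (h∈o[g] (tolerance p q) (0<tolerance p q))
  h-small : ∀ n → n ≥ N₀ → ∣ h n ∣ ℚ.≤ tolerance p q ℚ.* ∣ g n ∣
  h-small = proj₂ (h∈o[g] (tolerance p q) (0<tolerance p q))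
  bound : ∀ n → n ≥ N₀ + (8 * suc q + 2) → half n ℚ.≤ (1ℚ ℚ.+ ε) ℚ.* g n
  bound n n≥N = subst₂ (λ k e → half k ℚ.≤ (1ℚ ℚ.+ e) ℚ.* g k) 2+[n∸2]≡n (sym ε≡)
    (half-≤-from-hardInput p q (n ∸ 2) (ℕP.m+n≤o⇒m≤o∸n (8 * suc q) 8b+2≤n)
      (competitive-on-hardInput g h competitive (n ∸ 2))
      (h-small (2 + (n ∸ 2)) (subst (N₀ ≤_) (sym 2+[n∸2]≡n) (ℕP.m+n≤o⇒m≤o N₀ n≥N))))
    where
    8b+2≤n : 8 * suc q + 2 ≤ n
    8b+2≤n = ℕP.m+n≤o⇒n≤o N₀ n≥N
    2+[n∸2]≡n : 2 + (n ∸ 2) ≡ n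
    2+[n∸2]≡n = ℕP.m+[n∸m]≡n (ℕP.m+n≤o⇒n≤o (8 * suc q) 8b+2≤n)

theorem4 : HasCompetitiveFunction Eag half
theorem4 = ((λ _ → ½) , ½∈o[half] , Opt≤[half+½]*Eag) , half-minimal
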